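{- Let $m$ be an odd positive integer and $\delta\in\mathbb{F}_{2^{2m}}$. Then $$f(x)=x+\left(\mathrm{Tr}_m^{2m}(x)^{(2^{m+1}-1)/3}+\delta\right)^3$$ is a permutation polynomial of $\mathbb{F}_{2^{2m}}$ and its compositional inverse over $\mathbb{F}_{2^{2m}}$ is $$f^{ -1}(x)=x+\left(\left(\mathrm{Tr}_m^{2m}(x)+\delta^{2^{m+1}+1}+\delta^{2+2^m}\right)^{(2^{m+1}-1)/3}+\delta^{2^m}\right)^3.$$
   Context: $\mathrm{Tr}_m^{2m}(x)=x+x^{2^m}$ is the trace map from $\mathbb{F}_{2^{2m}}$ to $\mathbb{F}_{2^m}$. The compositional inverse of a permutation polynomial $F$ of a finite field $\mathbb{F}$ is the unique polynomial map $F^{ -1}$ with $F(F^{ -1}(x))=F^{ -1}(F(x))=x$ for all $x\in\mathbb{F}$. -}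

module Defs where

open import Level using (0ℓ)
open import Data.Nat using (ℕ; zero; suc)
open import Data.Fin using (Fin)
open import Data.Product using (Σ; _×_)
open import Function.Bundles using (_↔_)
open import Relation.Binary.PropositionalEquality using (_≡_)
open import Relation.Nullary using (¬_)
import Algebra.Structures as S

record FiniteField (q : ℕ) : Set₁ where
  infixl 7 _*_
  infixl 6 _+_
  field
    Carrier : Set
    _+_ _*_ : Carrier → Carrier → Carrier
    -_      : Carrier → Carrier
    0# 1#   : Carrier
    isCommutativeRing : S.IsCommutativeRing {A = Carrier} _≡_ _+_ _*_ -_ 0# 1#
    0≢1     : ¬ (0# ≡ 1#)
    inverse : ∀ x → ¬ (x ≡ 0#) → Σ Carrier (λ y → x * y ≡ 1#)
    enumeration : Fin q ↔ Carrier

  infixr 8 _^_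
  _^_ : Carrier → ℕ → Carrier
  x ^ zero  = 1#
  x ^ suc n = x * (x ^ n)

open import Data.Nat.DivMod using (_/_)
import Data.Nat as N

module _ {q : ℕ} (F : FiniteField q) (m : ℕ) where
  open FiniteField F

  -- the exponent (2^{m+1} - 1)/3 (exact division when m is odd)
  expo : ℕ
  expo = (2 N.^ (m N.+ 1) N.∸ 1) / 3

  Tr : Carrier → Carrier
  Tr x = x + x ^ (2 N.^ m)

  fmap : Carrier → Carrier → Carrier
  fmap δ x = x + ((Tr x) ^ expo + δ) ^ 3

  finv : Carrier → Carrier → Carrier
  finv δ x = x + (((Tr x + δ ^ (2 N.^ (m N.+ 1) N.+ 1)) + δ ^ (2 N.+ 2 N.^ m)) ^ expo + δ ^ (2 N.^ m)) ^ 3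

{-# OPTIONS --safe #-}
module Submission where

-- Let conj x = x ^ 2 ^ m, the generator of Gal(𝔽_{2^{2m}} / 𝔽_{2^m}); its fixed field K contains all
-- values of Tr. As m is odd, E = (2^{m+1} - 1) / 3 satisfies 3E + 1 = 2^{m+1}, so on K the maps
-- x ↦ x ^ 3 and x ↦ x ^ E are mutually inverse. With u = Tr x ^ E ∈ K we have f x = x + (u + δ)³, and
-- writing δ̄ = conj δ, the characteristic-2 identity
--   u³ + (u + δ)³ + (u + δ̄)³ + δ̄²δ + δ²δ̄ = (u + δ + δ̄)³
-- gives Tr (f x) + δ^{2^{m+1}+1} + δ^{2+2^m} = (u + δ + δ̄)³. Its E-th power is u + δ + δ̄, so f⁻¹ adds
-- (u + δ)³ once more and returns x. The same identity with δ and δ̄ exchanged shows that f undoes f⁻¹.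

open import Level using (0ℓ)
open import Defs
import Data.Nat as N
open N using (ℕ; zero; suc; NonZero)
import Data.Nat.Properties as NP
open import Data.Nat.DivMod using (_/_; m*n/n≡m)
open import Data.Nat.Tactic.RingSolver using (solve-∀)
open import Data.Fin as Fin using (Fin)
open import Data.Fin.Properties using (punchInᵢ≢i; nonZeroIndex)
open import Data.Fin.Permutation using (Permutation; permutation)
open import Data.Vec.Functional using (removeAt; replicate)
open import Data.Empty using (⊥-elim)
open import Data.Product using (Σ; ∃-syntax; _×_; _,_)
open import Function using (_∘_)
open import Function.Bundles using (Inverse)
open import Function.Properties.Inverse using (↔-sym; ↔⇒↣)
open import Function.Definitions using (Bijective)
open import Function.Consequences.Propositional
  using (inverseᵇ⇒bijective; strictlyInverseˡ⇒inverseˡ; strictlyInverseʳ⇒inverseʳ)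
open import Relation.Nullary using (yes; no)
open import Relation.Nullary.Decidable using (via-injection)
open import Relation.Binary.Definitions using (DecidableEquality)
open import Relation.Binary.PropositionalEquality
  using (_≡_; _≢_; refl; sym; trans; cong; cong₂; subst; module ≡-Reasoning)
open import Algebra.Bundles using (CommutativeMonoid; CommutativeRing)
import Algebra.Properties.CommutativeSemiring.Exp as ExpProperties
import Algebra.Properties.Ring as RingProperties

module _ {c ℓ} (M : CommutativeMonoid c ℓ) where
  open CommutativeMonoid M
  open import Algebra.Properties.CommutativeMonoid.Sum M
    using (sum; sum-remove; sum-cong-≋; sum-replicate-zero)
  open import Relation.Binary.Reasoning.Setoid setoid

  sum-supported-at : ∀ {n} (t : Fin n → Carrier) i → (∀ j → j ≢ i → t j ≈ ε) → sum t ≈ t i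
  sum-supported-at {suc n} t i vanishes = begin
    sum t                     ≈⟨ sum-remove {i = i} t ⟩
    t i ∙ sum (removeAt t i)  ≈⟨ ∙-congˡ (sum-cong-≋ (λ j → vanishes _ (punchInᵢ≢i i j))) ⟩
    t i ∙ sum (replicate n ε) ≈⟨ ∙-congˡ (sum-replicate-zero n) ⟩
    t i ∙ ε                   ≈⟨ identityʳ (t i) ⟩
    t i                       ∎

module FiniteFieldProperties {q : ℕ} (F : FiniteField q) where
  open FiniteField F
  open ≡-Reasoning

  commutativeRing : CommutativeRing 0ℓ 0ℓ
  commutativeRing = record { isCommutativeRing = isCommutativeRing }

  open CommutativeRing commutativeRing public
    using ( +-assoc; +-comm; +-identityʳ; *-assoc; *-comm; *-identityˡ; *-identityʳ
          ; zeroˡ; zeroʳ; distribʳ; -‿inverseʳ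
          ; commutativeSemiring; +-commutativeSemigroup; *-commutativeMonoid; ring )

  private
    module Exp = ExpProperties commutativeSemiring

  ^≗Exp^ : ∀ x n → x ^ n ≡ x Exp.^ n
  ^≗Exp^ x zero    = refl
  ^≗Exp^ x (suc n) = cong (x *_) (^≗Exp^ x n)

  ^-homo-* : ∀ x m n → x ^ (m N.+ n) ≡ x ^ m * x ^ n
  ^-homo-* x m n rewrite ^≗Exp^ x (m N.+ n) | ^≗Exp^ x m | ^≗Exp^ x n = Exp.^-homo-* x m n

  ^-assocʳ : ∀ x m n → (x ^ m) ^ n ≡ x ^ (m N.* n)
  ^-assocʳ x m n rewrite ^≗Exp^ (x ^ m) n | ^≗Exp^ x m | ^≗Exp^ x (m N.* n) = Exp.^-assocʳ x m n

  ^-distrib-* : ∀ x y n → (x * y) ^ n ≡ x ^ n * y ^ n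
  ^-distrib-* x y n rewrite ^≗Exp^ (x * y) n | ^≗Exp^ x n | ^≗Exp^ y n = Exp.^-distrib-* x y n

  1^n≡1 : ∀ n → 1# ^ n ≡ 1#
  1^n≡1 zero    = refl
  1^n≡1 (suc n) = trans (*-identityˡ _) (1^n≡1 n)

  0^n≡0 : ∀ n → .{{NonZero n}} → 0# ^ n ≡ 0#
  0^n≡0 (suc n) = zeroˡ _

  infix 4 _≟_
  _≟_ : DecidableEquality Carrier
  _≟_ = via-injection (↔⇒↣ (↔-sym enumeration)) Fin._≟_

  *-cancelˡ : ∀ {a x y} → a ≢ 0# → a * x ≡ a * y → x ≡ y
  *-cancelˡ {a} {x} {y} a≢0 ax≡ay with inverse a a≢0
  ... | a⁻¹ , aa⁻¹≡1 = begin
    x               ≡⟨ sym (*-identityˡ x) ⟩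
    1# * x          ≡⟨ cong (_* x) (trans (sym aa⁻¹≡1) (*-comm a a⁻¹)) ⟩
    a⁻¹ * a * x     ≡⟨ *-assoc a⁻¹ a x ⟩
    a⁻¹ * (a * x)   ≡⟨ cong (a⁻¹ *_) ax≡ay ⟩
    a⁻¹ * (a * y)   ≡⟨ *-assoc a⁻¹ a y ⟨
    a⁻¹ * a * y     ≡⟨ cong (_* y) (trans (*-comm a⁻¹ a) aa⁻¹≡1) ⟩
    1# * y          ≡⟨ *-identityˡ y ⟩
    y               ∎

  *-nonzero : ∀ {a b} → a ≢ 0# → b ≢ 0# → a * b ≢ 0#
  *-nonzero {a} a≢0 b≢0 ab≡0 = b≢0 (*-cancelˡ a≢0 (trans ab≡0 (sym (zeroʳ a))))

  x^[1+n]≡x²⇒x^n≡x : ∀ x n → .{{NonZero n}} → x ^ suc n ≡ x ^ 2 → x ^ n ≡ x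
  x^[1+n]≡x²⇒x^n≡x x n eq with x ≟ 0#
  ... | yes refl = 0^n≡0 n
  ... | no x≢0   = *-cancelˡ x≢0 (trans eq (cong (x *_) (*-identityʳ x)))

  open Inverse enumeration using (to; from; strictlyInverseˡ; strictlyInverseʳ)
  open import Algebra.Properties.CommutativeMonoid.Sum *-commutativeMonoid
    using (sum-permute; sum-cong-≗; ∑-distrib-+; sum-replicate)
    renaming (sum to ∏)

  ∏-nonzero : ∀ {n} (t : Fin n → Carrier) → (∀ i → t i ≢ 0#) → ∏ t ≢ 0#
  ∏-nonzero {zero}  t _   = 0≢1 ∘ sym
  ∏-nonzero {suc n} t t≢0 = *-nonzero (t≢0 Fin.zero) (∏-nonzero (t ∘ Fin.suc) (t≢0 ∘ Fin.suc))

  ∏-scaling-invariant : ∀ (h : Carrier → Carrier) {a} → a ≢ 0# → ∏ (h ∘ to) ≡ ∏ (λ i → h (a * to i))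
  ∏-scaling-invariant h {a} a≢0 with inverse a a≢0
  ... | a⁻¹ , aa⁻¹≡1 = trans (sum-permute (h ∘ to) scaling)
                             (sum-cong-≗ (λ i → cong h (strictlyInverseˡ (a * to i))))
    where
    rescale-back : ∀ {b c} → b * c ≡ 1# → ∀ i → from (b * to (from (c * to i))) ≡ i
    rescale-back {b} {c} bc≡1 i = begin
      from (b * to (from (c * to i)))  ≡⟨ cong (λ y → from (b * y)) (strictlyInverseˡ _) ⟩
      from (b * (c * to i))            ≡⟨ cong from (*-assoc b c _) ⟨
      from (b * c * to i)              ≡⟨ cong (λ y → from (y * to i)) bc≡1 ⟩
      from (1# * to i)                 ≡⟨ cong from (*-identityˡ _) ⟩
      from (to i)                      ≡⟨ strictlyInverseʳ i ⟩
      i                                ∎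
    scaling : Permutation q q
    scaling = permutation (λ i → from (a * to i)) (λ i → from (a⁻¹ * to i))
                          (rescale-back aa⁻¹≡1) (rescale-back (trans (*-comm a⁻¹ a) aa⁻¹≡1))

  -- Scaling by x ≠ 0 permutes the field. nonzeroPart turns the factor 0 into 1 so that the product
  -- over all elements is invertible, and atZero is the correction needed at the single element 0.
  nonzeroPart : Carrier → Carrier
  nonzeroPart x with x ≟ 0#
  ... | yes _ = 1#
  ... | no _  = x

  atZero : Carrier → Carrier → Carrier
  atZero a x with x ≟ 0#
  ... | yes _ = a
  ... | no _  = 1#

  nonzeroPart≢0 : ∀ x → nonzeroPart x ≢ 0#
  nonzeroPart≢0 x with x ≟ 0#
  ... | yes _   = 0≢1 ∘ sym
  ... | no x≢0 = x≢0

  *-nonzeroPart : ∀ {a} x → a ≢ 0# → a * nonzeroPart x ≡ nonzeroPart (a * x) * atZero a x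
  *-nonzeroPart {a} x a≢0 with x ≟ 0# | a * x ≟ 0#
  ... | yes _   | yes _    = *-comm a 1#
  ... | yes x≡0 | no ax≢0  = ⊥-elim (ax≢0 (trans (cong (a *_) x≡0) (zeroʳ a)))
  ... | no x≢0  | yes ax≡0 = ⊥-elim (*-nonzero a≢0 x≢0 ax≡0)
  ... | no _    | no _     = sym (*-identityʳ (a * x))

  ∏-atZero : ∀ a → ∏ (λ i → atZero a (to i)) ≡ a
  ∏-atZero a = trans (sum-supported-at *-commutativeMonoid _ (from 0#) atZero≡1)
                     (trans (cong (atZero a) (strictlyInverseˡ 0#)) atZero-0)
    where
    atZero-0 : atZero a 0# ≡ a
    atZero-0 with 0# ≟ 0#
    ... | yes _   = refl
    ... | no 0≢0 = ⊥-elim (0≢0 refl)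
    atZero≡1 : ∀ i → i ≢ from 0# → atZero a (to i) ≡ 1#
    atZero≡1 i i≢i₀ with to i ≟ 0#
    ... | yes toi≡0 = ⊥-elim (i≢i₀ (trans (sym (strictlyInverseʳ i)) (cong from toi≡0)))
    ... | no _      = refl

  x^q≡x : ∀ x → x ^ q ≡ x
  x^q≡x x with x ≟ 0#
  ... | yes refl = 0^n≡0 q {{nonZeroIndex (from 0#)}}
  ... | no x≢0   = *-cancelˡ (∏-nonzero (nonzeroPart ∘ to) (nonzeroPart≢0 ∘ to)) (begin
    P * x ^ q                          ≡⟨ *-comm P _ ⟩
    x ^ q * P                          ≡⟨ cong (_* P) (trans (^≗Exp^ x q) (sym (sum-replicate q))) ⟩
    ∏ (replicate q x) * P              ≡⟨ ∑-distrib-+ (replicate q x) _ ⟨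
    ∏ (λ i → x * nonzeroPart (to i))   ≡⟨ sum-cong-≗ (λ i → *-nonzeroPart (to i) x≢0) ⟩
    ∏ (λ i → scaled i * correction i)  ≡⟨ ∑-distrib-+ scaled correction ⟩
    ∏ scaled * ∏ correction            ≡⟨ cong₂ _*_ (sym (∏-scaling-invariant nonzeroPart x≢0)) (∏-atZero x) ⟩
    P * x                              ∎)
    where
    P : Carrier
    P = ∏ (nonzeroPart ∘ to)
    scaled correction : Fin q → Carrier
    scaled i     = nonzeroPart (x * to i)
    correction i = atZero x (to i)

  even-order⇒x+x≡0 : ∀ r → q ≡ 2 N.* r → ∀ x → x + x ≡ 0#
  even-order⇒x+x≡0 r q≡2r x = begin
    x + x              ≡⟨ cong₂ _+_ (*-identityˡ x) (*-identityˡ x) ⟨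
    1# * x + 1# * x    ≡⟨ distribʳ x 1# 1# ⟨
    (1# + 1#) * x      ≡⟨ cong (λ y → (1# + y) * x) -1≡1 ⟨
    (1# + - 1#) * x    ≡⟨ cong (_* x) (-‿inverseʳ 1#) ⟩
    0# * x             ≡⟨ zeroˡ x ⟩
    0#                 ∎
    where
    open RingProperties ring using (-1*x≈-x; -‿involutive)
    -1≡1 : - 1# ≡ 1#
    -1≡1 = begin
      - 1#                ≡⟨ x^q≡x (- 1#) ⟨
      (- 1#) ^ q          ≡⟨ cong ((- 1#) ^_) q≡2r ⟩
      (- 1#) ^ (2 N.* r)  ≡⟨ ^-assocʳ (- 1#) 2 r ⟨
      ((- 1#) ^ 2) ^ r    ≡⟨ cong (λ y → (- 1# * y) ^ r) (*-identityʳ (- 1#)) ⟩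
      (- 1# * - 1#) ^ r   ≡⟨ cong (_^ r) (trans (-1*x≈-x (- 1#)) (-‿involutive 1#)) ⟩
      1# ^ r              ≡⟨ 1^n≡1 r ⟩
      1#                  ∎

  module Characteristic2 (x+x≡0 : ∀ x → x + x ≡ 0#) where
    open import Algebra.Solver.Ring.NaturalCoefficients.Default commutativeSemiring
      using (solve; _:=_; _:+_; _:*_)

    x+[y+y]≡x : ∀ x y → x + (y + y) ≡ x
    x+[y+y]≡x x y = trans (cong (x +_) (x+x≡0 y)) (+-identityʳ x)

    x+y+y≡x : ∀ x y → x + y + y ≡ x
    x+y+y≡x x y = trans (+-assoc x y y) (x+[y+y]≡x x y)

    x^2≡x*x : ∀ x → x ^ 2 ≡ x * x
    x^2≡x*x x = cong (x *_) (*-identityʳ x)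

    x^3≡x*[x*x] : ∀ x → x ^ 3 ≡ x * (x * x)
    x^3≡x*[x*x] x = cong (x *_) (x^2≡x*x x)

    [x+y]²≡x²+y² : ∀ x y → (x + y) ^ 2 ≡ x ^ 2 + y ^ 2
    [x+y]²≡x²+y² x y = begin
      (x + y) ^ 2            ≡⟨ x^2≡x*x (x + y) ⟩
      (x + y) * (x + y)      ≡⟨ solve 2 (λ x y → (x :+ y) :* (x :+ y) := x :* x :+ y :* y :+ (x :* y :+ x :* y))
                                        refl x y ⟩
      x * x + y * y + (x * y + x * y)  ≡⟨ x+[y+y]≡x (x * x + y * y) (x * y) ⟩
      x * x + y * y          ≡⟨ cong₂ _+_ (x^2≡x*x x) (x^2≡x*x y) ⟨
      x ^ 2 + y ^ 2          ∎

    frobenius-+ : ∀ k x y → (x + y) ^ (2 N.^ k) ≡ x ^ (2 N.^ k) + y ^ (2 N.^ k)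
    frobenius-+ zero    x y = trans (*-identityʳ (x + y)) (sym (cong₂ _+_ (*-identityʳ x) (*-identityʳ y)))
    frobenius-+ (suc k) x y = begin
      (x + y) ^ (2 N.* 2 N.^ k)              ≡⟨ ^-assocʳ (x + y) 2 (2 N.^ k) ⟨
      ((x + y) ^ 2) ^ 2 N.^ k                ≡⟨ cong (_^ 2 N.^ k) ([x+y]²≡x²+y² x y) ⟩
      (x ^ 2 + y ^ 2) ^ 2 N.^ k              ≡⟨ frobenius-+ k (x ^ 2) (y ^ 2) ⟩
      (x ^ 2) ^ 2 N.^ k + (y ^ 2) ^ 2 N.^ k  ≡⟨ cong₂ _+_ (^-assocʳ x 2 (2 N.^ k)) (^-assocʳ y 2 (2 N.^ k)) ⟩
      x ^ (2 N.* 2 N.^ k) + y ^ (2 N.* 2 N.^ k)  ∎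

    cube-identity : ∀ u a b → u ^ 3 + ((u + a) ^ 3 + (u + b) ^ 3) + b * (b * a) + a * (a * b) ≡ (u + (a + b)) ^ 3
    cube-identity u a b = begin
      u ^ 3 + ((u + a) ^ 3 + (u + b) ^ 3) + b * (b * a) + a * (a * b)
        ≡⟨ cong (λ t → t + b * (b * a) + a * (a * b))
                (cong₂ _+_ (x^3≡x*[x*x] u) (cong₂ _+_ (x^3≡x*[x*x] (u + a)) (x^3≡x*[x*x] (u + b)))) ⟩
      u ³ + ((u + a) ³ + (u + b) ³) + b * (b * a) + a * (a * b)
        ≡⟨ x+[y+y]≡x _ w ⟨
      u ³ + ((u + a) ³ + (u + b) ³) + b * (b * a) + a * (a * b) + (w + w)
        -- with the doubled terms w + w and u³ + u³ added this is an identity of commutative semirings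
        ≡⟨ solve 3 (λ u a b →
             u :* (u :* u) :+ ((u :+ a) :* ((u :+ a) :* (u :+ a)) :+ (u :+ b) :* ((u :+ b) :* (u :+ b)))
               :+ b :* (b :* a) :+ a :* (a :* b)
               :+ ((u :* a :* b :+ u :* a :* b :+ u :* a :* b :+ a :* (a :* b) :+ b :* (b :* a))
                   :+ (u :* a :* b :+ u :* a :* b :+ u :* a :* b :+ a :* (a :* b) :+ b :* (b :* a)))
             := (u :+ (a :+ b)) :* ((u :+ (a :+ b)) :* (u :+ (a :+ b))) :+ (u :* (u :* u) :+ u :* (u :* u)))
             refl u a b ⟩
      (u + (a + b)) ³ + (u ³ + u ³)
        ≡⟨ x+[y+y]≡x _ (u ³) ⟩
      (u + (a + b)) ³
        ≡⟨ x^3≡x*[x*x] (u + (a + b)) ⟨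
      (u + (a + b)) ^ 3 ∎
      where
      _³ : Carrier → Carrier
      x ³ = x * (x * x)
      w : Carrier
      w = u * a * b + u * a * b + u * a * b + a * (a * b) + b * (b * a)

module Conjugation (n : ℕ) (F : FiniteField (2 N.^ (2 N.* suc n))) where
  open FiniteField F
  open FiniteFieldProperties F public
  open import Algebra.Properties.CommutativeSemigroup +-commutativeSemigroup using (interchange; xy∙z≈xz∙y)
  open ≡-Reasoning

  m : ℕ
  m = suc n

  -- the order 2 ^ (2 * suc n) unfolds to 2 * 2 ^ (n + 1 * suc n)
  x+x≡0 : ∀ x → x + x ≡ 0#
  x+x≡0 = even-order⇒x+x≡0 (2 N.^ (n N.+ m)) (cong (λ e → 2 N.* 2 N.^ (n N.+ e)) (NP.*-identityˡ m))

  open Characteristic2 x+x≡0 public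

  conj : Carrier → Carrier
  conj x = x ^ 2 N.^ m

  Fixed : Carrier → Set
  Fixed x = conj x ≡ x

  conj-involutive : ∀ x → conj (conj x) ≡ x
  conj-involutive x = begin
    (x ^ 2 N.^ m) ^ 2 N.^ m      ≡⟨ ^-assocʳ x (2 N.^ m) (2 N.^ m) ⟩
    x ^ (2 N.^ m N.* 2 N.^ m)    ≡⟨ cong (x ^_) (NP.^-distribˡ-+-* 2 m m) ⟨
    x ^ (2 N.^ (m N.+ m))        ≡⟨ cong (λ e → x ^ 2 N.^ (m N.+ e)) (NP.+-identityʳ m) ⟨
    x ^ (2 N.^ (2 N.* m))        ≡⟨ x^q≡x x ⟩
    x                            ∎

  conj-homo-+ : ∀ x y → conj (x + y) ≡ conj x + conj y
  conj-homo-+ = frobenius-+ m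

  conj-homo-* : ∀ x y → conj (x * y) ≡ conj x * conj y
  conj-homo-* x y = ^-distrib-* x y (2 N.^ m)

  conj-^ : ∀ x k → conj (x ^ k) ≡ conj x ^ k
  conj-^ x k = begin
    (x ^ k) ^ 2 N.^ m      ≡⟨ ^-assocʳ x k (2 N.^ m) ⟩
    x ^ (k N.* 2 N.^ m)    ≡⟨ cong (x ^_) (NP.*-comm k (2 N.^ m)) ⟩
    x ^ (2 N.^ m N.* k)    ≡⟨ ^-assocʳ x (2 N.^ m) k ⟨
    (x ^ 2 N.^ m) ^ k      ∎

  Fixed-+ : ∀ {x y} → Fixed x → Fixed y → Fixed (x + y)
  Fixed-+ {x} {y} x-fixed y-fixed = trans (conj-homo-+ x y) (cong₂ _+_ x-fixed y-fixed)

  Fixed-^ : ∀ {x} k → Fixed x → Fixed (x ^ k)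
  Fixed-^ {x} k x-fixed = trans (conj-^ x k) (cong (_^ k) x-fixed)

  Tr-fixed : ∀ x → Fixed (Tr F m x)
  Tr-fixed x = begin
    conj (x + conj x)          ≡⟨ conj-homo-+ x (conj x) ⟩
    conj x + conj (conj x)     ≡⟨ cong (conj x +_) (conj-involutive x) ⟩
    conj x + x                 ≡⟨ +-comm (conj x) x ⟩
    x + conj x                 ∎

  Tr-homo-+ : ∀ x y → Tr F m (x + y) ≡ Tr F m x + Tr F m y
  Tr-homo-+ x y = begin
    x + y + conj (x + y)          ≡⟨ cong (x + y +_) (conj-homo-+ x y) ⟩
    x + y + (conj x + conj y)     ≡⟨ interchange x y (conj x) (conj y) ⟩
    x + conj x + (y + conj y)     ∎

  Tr-shifted-cube : ∀ {u} a → Fixed u → Tr F m ((u + a) ^ 3) ≡ (u + a) ^ 3 + (u + conj a) ^ 3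
  Tr-shifted-cube {u} a u-fixed = cong ((u + a) ^ 3 +_) (begin
    conj ((u + a) ^ 3)     ≡⟨ conj-^ (u + a) 3 ⟩
    conj (u + a) ^ 3       ≡⟨ cong (_^ 3) (trans (conj-homo-+ u a) (cong (_+ conj a) u-fixed)) ⟩
    (u + conj a) ^ 3       ∎)

4^n≡1+t*3 : ∀ n → ∃[ t ] 4 N.^ n ≡ suc (t N.* 3)
4^n≡1+t*3 zero = 0 , refl
4^n≡1+t*3 (suc n) with 4^n≡1+t*3 n
... | t , ih = suc (t N.* 4) , trans (cong (4 N.*_) ih) (step t)
  where
  step : ∀ t → 4 N.* suc (t N.* 3) ≡ suc (suc (t N.* 4) N.* 3)
  step = solve-∀

module OddDegree (k : ℕ) (F : FiniteField (2 N.^ (2 N.* suc (2 N.* k)))) (δ : FiniteField.Carrier F) where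
  open FiniteField F
  open Conjugation (2 N.* k) F
  open import Algebra.Properties.CommutativeSemigroup +-commutativeSemigroup using (xy∙z≈xz∙y)
  open ≡-Reasoning

  E : ℕ
  E = expo F m

  2^[m+1]≡2^m*2 : 2 N.^ (m N.+ 1) ≡ 2 N.^ m N.* 2
  2^[m+1]≡2^m*2 = NP.^-distribˡ-+-* 2 m 1

  1+E*3≡2^m*2 : suc (E N.* 3) ≡ 2 N.^ m N.* 2
  1+E*3≡2^m*2 with 4^n≡1+t*3 (suc k)
  ... | t , 4^[1+k]≡1+t*3 = begin
    suc (E N.* 3)     ≡⟨ cong (λ e → suc (e N.* 3)) E≡t ⟩
    suc (t N.* 3)     ≡⟨ trans 2^[m+1]≡4^[1+k] 4^[1+k]≡1+t*3 ⟨
    2 N.^ (m N.+ 1)   ≡⟨ 2^[m+1]≡2^m*2 ⟩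
    2 N.^ m N.* 2     ∎
    where
    m+1≡2*[1+k] : ∀ j → suc (2 N.* j) N.+ 1 ≡ 2 N.* suc j
    m+1≡2*[1+k] = solve-∀
    2^[m+1]≡4^[1+k] : 2 N.^ (m N.+ 1) ≡ 4 N.^ suc k
    2^[m+1]≡4^[1+k] = trans (cong (2 N.^_) (m+1≡2*[1+k] k)) (sym (NP.^-*-assoc 2 2 (suc k)))
    E≡t : E ≡ t
    E≡t = trans (cong (λ e → (e N.∸ 1) / 3) (trans 2^[m+1]≡4^[1+k] 4^[1+k]≡1+t*3)) (m*n/n≡m t 3)

  E*3≢0 : E N.* 3 ≢ 0
  E*3≢0 E*3≡0 with NP.m*n≡1⇒n≡1 (2 N.^ m) 2 (trans (sym 1+E*3≡2^m*2) (cong suc E*3≡0))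
  ... | ()

  x^[E*3]≡x : ∀ {x} → Fixed x → x ^ (E N.* 3) ≡ x
  x^[E*3]≡x {x} x-fixed = x^[1+n]≡x²⇒x^n≡x x (E N.* 3) {{N.≢-nonZero E*3≢0}} (begin
    x ^ suc (E N.* 3)      ≡⟨ cong (x ^_) 1+E*3≡2^m*2 ⟩
    x ^ (2 N.^ m N.* 2)    ≡⟨ ^-assocʳ x (2 N.^ m) 2 ⟨
    conj x ^ 2             ≡⟨ cong (_^ 2) x-fixed ⟩
    x ^ 2                  ∎)

  [x^E]^3≡x : ∀ {x} → Fixed x → (x ^ E) ^ 3 ≡ x
  [x^E]^3≡x {x} x-fixed = trans (^-assocʳ x E 3) (x^[E*3]≡x x-fixed)

  [x^3]^E≡x : ∀ {x} → Fixed x → (x ^ 3) ^ E ≡ x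
  [x^3]^E≡x {x} x-fixed = trans (^-assocʳ x 3 E) (trans (cong (x ^_) (NP.*-comm 3 E)) (x^[E*3]≡x x-fixed))

  δ̄ : Carrier
  δ̄ = conj δ

  -- the two δ-powers in finv; c₂ is δ ^ (2 + 2 ^ m) definitionally
  c₁ c₂ : Carrier
  c₁ = δ̄ * (δ̄ * δ)
  c₂ = δ * (δ * δ̄)

  conj-x*[x*y] : ∀ x y → conj (x * (x * y)) ≡ conj x * (conj x * conj y)
  conj-x*[x*y] x y = trans (conj-homo-* x (x * y)) (cong (conj x *_) (conj-homo-* x y))

  δ^[2^[m+1]+1]≡c₁ : δ ^ (2 N.^ (m N.+ 1) N.+ 1) ≡ c₁
  δ^[2^[m+1]+1]≡c₁ = begin
    δ ^ (2 N.^ (m N.+ 1) N.+ 1)     ≡⟨ ^-homo-* δ (2 N.^ (m N.+ 1)) 1 ⟩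
    δ ^ 2 N.^ (m N.+ 1) * δ ^ 1     ≡⟨ cong₂ _*_ (cong (δ ^_) 2^[m+1]≡2^m*2) (*-identityʳ δ) ⟩
    δ ^ (2 N.^ m N.* 2) * δ         ≡⟨ cong (_* δ) (trans (sym (^-assocʳ δ (2 N.^ m) 2)) (x^2≡x*x δ̄)) ⟩
    δ̄ * δ̄ * δ                       ≡⟨ *-assoc δ̄ δ̄ δ ⟩
    c₁                              ∎

  finvArg : Carrier → Carrier
  finvArg y = Tr F m y + δ ^ (2 N.^ (m N.+ 1) N.+ 1) + δ ^ (2 N.+ 2 N.^ m)

  finvArg≡ : ∀ y → finvArg y ≡ Tr F m y + c₁ + c₂
  finvArg≡ y = cong (λ c → Tr F m y + c + c₂) δ^[2^[m+1]+1]≡c₁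

  finvArg-fixed : ∀ y → Fixed (finvArg y)
  finvArg-fixed y = subst Fixed (sym (finvArg≡ y)) (begin
    conj (Tr F m y + c₁ + c₂)                 ≡⟨ conj-homo-+ _ c₂ ⟩
    conj (Tr F m y + c₁) + conj c₂            ≡⟨ cong (_+ conj c₂) (conj-homo-+ _ c₁) ⟩
    conj (Tr F m y) + conj c₁ + conj c₂       ≡⟨ cong₂ (λ t c → t + conj c₁ + c) (Tr-fixed y) conj-c₂ ⟩
    Tr F m y + conj c₁ + c₁                   ≡⟨ cong (λ c → Tr F m y + c + c₁) conj-c₁ ⟩
    Tr F m y + c₂ + c₁                        ≡⟨ xy∙z≈xz∙y (Tr F m y) c₂ c₁ ⟩
    Tr F m y + c₁ + c₂                        ∎)
    where
    conj-c₁ : conj c₁ ≡ c₂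
    conj-c₁ = trans (conj-x*[x*y] δ̄ δ) (cong (λ x → x * (x * δ̄)) (conj-involutive δ))
    conj-c₂ : conj c₂ ≡ c₁
    conj-c₂ = trans (conj-x*[x*y] δ δ̄) (cong (λ x → δ̄ * (δ̄ * x)) (conj-involutive δ))

  finv∘fmap : ∀ x → finv F m δ (fmap F m δ x) ≡ x
  finv∘fmap x = begin
    y + (finvArg y ^ E + δ̄) ^ 3   ≡⟨ cong (λ s → y + (s + δ̄) ^ 3) finvArg[y]^E ⟩
    y + (u + (δ + δ̄) + δ̄) ^ 3     ≡⟨ cong (λ s → y + (s + δ̄) ^ 3) (+-assoc u δ δ̄) ⟨
    y + (u + δ + δ̄ + δ̄) ^ 3       ≡⟨ cong (λ s → y + s ^ 3) (x+y+y≡x (u + δ) δ̄) ⟩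
    y + (u + δ) ^ 3               ≡⟨ x+y+y≡x x _ ⟩
    x                             ∎
    where
    u y : Carrier
    u = Tr F m x ^ E
    y = fmap F m δ x
    u-fixed : Fixed u
    u-fixed = Fixed-^ E (Tr-fixed x)
    Tr[y] : Tr F m y ≡ u ^ 3 + ((u + δ) ^ 3 + (u + δ̄) ^ 3)
    Tr[y] = trans (Tr-homo-+ x _) (cong₂ _+_ (sym ([x^E]^3≡x (Tr-fixed x))) (Tr-shifted-cube δ u-fixed))
    finvArg[y]^E : finvArg y ^ E ≡ u + (δ + δ̄)
    finvArg[y]^E = begin
      finvArg y ^ E                                         ≡⟨ cong (_^ E) (finvArg≡ y) ⟩
      (Tr F m y + c₁ + c₂) ^ E                              ≡⟨ cong (λ t → (t + c₁ + c₂) ^ E) Tr[y] ⟩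
      (u ^ 3 + ((u + δ) ^ 3 + (u + δ̄) ^ 3) + c₁ + c₂) ^ E  ≡⟨ cong (_^ E) (cube-identity u δ δ̄) ⟩
      ((u + (δ + δ̄)) ^ 3) ^ E                               ≡⟨ [x^3]^E≡x (Fixed-+ u-fixed (Tr-fixed δ)) ⟩
      u + (δ + δ̄)                                           ∎

  fmap∘finv : ∀ y → fmap F m δ (finv F m δ y) ≡ y
  fmap∘finv y = begin
    z + (Tr F m z ^ E + δ) ^ 3    ≡⟨ cong (λ s → z + (s + δ) ^ 3) Tr[z]^E ⟩
    z + (v + (δ̄ + δ) + δ) ^ 3     ≡⟨ cong (λ s → z + (s + δ) ^ 3) (+-assoc v δ̄ δ) ⟨
    z + (v + δ̄ + δ + δ) ^ 3       ≡⟨ cong (λ s → z + s ^ 3) (x+y+y≡x (v + δ̄) δ) ⟩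
    z + (v + δ̄) ^ 3               ≡⟨ x+y+y≡x y _ ⟩
    y                             ∎
    where
    v z : Carrier
    v = finvArg y ^ E
    z = finv F m δ y
    v-fixed : Fixed v
    v-fixed = Fixed-^ E (finvArg-fixed y)
    Tr[y] : Tr F m y ≡ v ^ 3 + c₂ + c₁
    Tr[y] = begin
      Tr F m y                        ≡⟨ x+y+y≡x (Tr F m y) c₁ ⟨
      Tr F m y + c₁ + c₁              ≡⟨ cong (_+ c₁) (x+y+y≡x (Tr F m y + c₁) c₂) ⟨
      Tr F m y + c₁ + c₂ + c₂ + c₁    ≡⟨ cong (λ t → t + c₂ + c₁) (finvArg≡ y) ⟨
      finvArg y + c₂ + c₁             ≡⟨ cong (λ t → t + c₂ + c₁) ([x^E]^3≡x (finvArg-fixed y)) ⟨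
      v ^ 3 + c₂ + c₁                 ∎
    P : Carrier
    P = (v + δ̄) ^ 3 + (v + δ) ^ 3
    Tr[[v+δ̄]³] : Tr F m ((v + δ̄) ^ 3) ≡ P
    Tr[[v+δ̄]³] = trans (Tr-shifted-cube δ̄ v-fixed) (cong (λ x → (v + δ̄) ^ 3 + (v + x) ^ 3) (conj-involutive δ))
    Tr[z] : Tr F m z ≡ (v + (δ̄ + δ)) ^ 3
    Tr[z] = begin
      Tr F m z                          ≡⟨ Tr-homo-+ y _ ⟩
      Tr F m y + Tr F m ((v + δ̄) ^ 3)  ≡⟨ cong₂ _+_ Tr[y] Tr[[v+δ̄]³] ⟩
      v ^ 3 + c₂ + c₁ + P               ≡⟨ xy∙z≈xz∙y (v ^ 3 + c₂) c₁ P ⟩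
      v ^ 3 + c₂ + P + c₁               ≡⟨ cong (_+ c₁) (xy∙z≈xz∙y (v ^ 3) c₂ P) ⟩
      v ^ 3 + P + c₂ + c₁               ≡⟨ cube-identity v δ̄ δ ⟩
      (v + (δ̄ + δ)) ^ 3                 ∎
    δ̄+δ-fixed : Fixed (δ̄ + δ)
    δ̄+δ-fixed = subst Fixed (+-comm δ δ̄) (Tr-fixed δ)
    Tr[z]^E : Tr F m z ^ E ≡ v + (δ̄ + δ)
    Tr[z]^E = trans (cong (_^ E) Tr[z]) ([x^3]^E≡x (Fixed-+ v-fixed δ̄+δ-fixed))

open import Data.Nat using (_*_; _^_)

theorem8 : (m : ℕ) → Σ ℕ (λ k → m ≡ suc (2 * k))
    → (F : FiniteField (2 ^ (2 * m)))
    → (δ : FiniteField.Carrier F)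
    → Bijective _≡_ _≡_ (fmap F m δ)
      × ((∀ x → fmap F m δ (finv F m δ x) ≡ x) × (∀ x → finv F m δ (fmap F m δ x) ≡ x))
theorem8 .(suc (2 * k)) (k , refl) F δ =
  inverseᵇ⇒bijective (strictlyInverseˡ⇒inverseˡ f fmap∘finv , strictlyInverseʳ⇒inverseʳ f finv∘fmap)
  , fmap∘finv , finv∘fmap
  where
  open OddDegree k F δ
  f : FiniteField.Carrier F → FiniteField.Carrier F
  f = fmap F (suc (2 * k)) δ
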